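{- Let $\widehat\Pi=\{(\alpha,\beta)\in\mathbb{Z}^2\colon \ell_0\le\alpha+\beta\le u_0,\ \ell_1\le\alpha\le u_1,\ \ell_2\le\beta\le u_2\}$ for some integers $\ell_i,u_i$ ($i\in\{0,1,2\}$). If $\widehat\Pi$ contains no interior pairs, then $\widehat\Pi$ contains at most four vertex pairs.
   Context: Let $\mathcal{D}=\{\pm(1,0),\pm(0,1),\pm(1,-1)\}$. A pair $(\alpha,\beta)\in\widehat\Pi$ is an interior pair if $(\alpha,\beta)+v\in\widehat\Pi$ for all $v\in\mathcal{D}$; a border pair if $(\alpha,\beta)\pm v\in\widehat\Pi$ for exactly two $v\in\mathcal{D}$; and a vertex pair if it is neither an interior nor a border pair. -}

module Defs where

open import Data.Integer using (ℤ; _+_; _-_; _≤_; _≤?_; +_; -_; 0ℤ; 1ℤ)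
open import Data.Product using (_×_; _,_; proj₁; proj₂)
open import Data.List using (List; []; _∷_; filter; length)
open import Data.List.Relation.Unary.All using (All)
open import Data.Nat using (ℕ)
open import Relation.Nullary using (¬_; Dec)
open import Relation.Nullary.Decidable using (_×-dec_)
open import Relation.Binary.PropositionalEquality using (_≡_)

Pair : Set
Pair = ℤ × ℤ

_⊕_ : Pair → Pair → Pair
(a , b) ⊕ (c , d) = (a + c , b + d)

_⊖_ : Pair → Pair → Pair
(a , b) ⊖ (c , d) = (a - c , b - d)

record Bounds : Set where
  constructor bounds
  field
    ℓ₀ u₀ ℓ₁ u₁ ℓ₂ u₂ : ℤ

InΠ : Bounds → Pair → Set
InΠ B (α , β) =
  (ℓ₀ ≤ α + β × α + β ≤ u₀) × (ℓ₁ ≤ α × α ≤ u₁) × (ℓ₂ ≤ β × β ≤ u₂)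
  where open Bounds B

inΠ? : (B : Bounds) (p : Pair) → Dec (InΠ B p)
inΠ? B (α , β) =
  ((ℓ₀ ≤? α + β) ×-dec (α + β ≤? u₀)) ×-dec
  (((ℓ₁ ≤? α) ×-dec (α ≤? u₁)) ×-dec ((ℓ₂ ≤? β) ×-dec (β ≤? u₂)))
  where open Bounds B

𝒟 : List Pair
𝒟 = (1ℤ , 0ℤ) ∷ (- 1ℤ , 0ℤ) ∷ (0ℤ , 1ℤ) ∷ (0ℤ , - 1ℤ)
  ∷ (1ℤ , - 1ℤ) ∷ (- 1ℤ , 1ℤ) ∷ []

Interior : Bounds → Pair → Set
Interior B p = InΠ B p × All (λ v → InΠ B (p ⊕ v)) 𝒟

countBoth : Bounds → Pair → ℕ
countBoth B p = length (filter (λ v → inΠ? B (p ⊕ v) ×-dec inΠ? B (p ⊖ v)) 𝒟)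

Border : Bounds → Pair → Set
Border B p = InΠ B p × countBoth B p ≡ 2

Vertex : Bounds → Pair → Set
Vertex B p = InΠ B p × ¬ Interior B p × ¬ Border B p

module Submission where

-- A pair p = (α , β) ∈ Π̂ has three coordinates α + β, α and β, each confined to an interval; call one
-- tight when it sits at an end of its interval. Every v ∈ 𝒟 moves exactly two coordinates, by ±1, so
-- p ± v ∈ Π̂ iff neither coordinate moved by v is tight. With no tight coordinate p is interior; with
-- exactly one, only the two directions fixing it survive and p is a border pair. So a vertex pair is a
-- corner: two of its coordinates are tight.
-- If Π̂ has no interior pair, then some coordinate takes at most two values, or one of the triangles
-- {α ≥ ℓ₁, β ≥ ℓ₂, α + β ≤ u₀} and {α ≤ u₁, β ≤ u₂, α + β ≥ ℓ₀} has side at most 2; otherwise a pair with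
-- all three coordinates strictly inside exists. The maps (α , β) ↦ (β , α), (α + β , - β), (- α , - β)
-- permute the coordinates of Π̂ and leave two cases: α takes at most two values, and each line α = const
-- carries at most two corners, its ends; or the first triangle is small, and every corner is one of its
-- three vertices.

open import Defs
open import Data.List using (List; length)
open import Data.List.Relation.Unary.All using (All)
open import Data.List.Relation.Unary.Unique.Propositional using (Unique)
open import Data.Product using (Σ)
open import Relation.Nullary using (¬_)

open import Data.Bool using (true; false)
open import Data.Fin using (Fin)
import Data.Fin as Fin
import Data.Fin.Properties as Fin
open import Data.List using ([]; _∷_; filter; lookup)
open import Data.List.Membership.Propositional using (_∈_)
open import Data.List.Membership.Propositional.Properties using (∈-lookup)
open import Data.List.Relation.Binary.Subset.Propositional using (_⊆_)
import Data.List.Relation.Unary.All as All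
open import Data.List.Relation.Unary.AllPairs using (_∷_)
open import Data.List.Relation.Unary.Any using (index)
open import Data.List.Relation.Unary.Any.Properties using (lookup-index)
import Data.Nat as ℕ
import Data.Nat.Properties as ℕ
open import Data.Product using (_,_)
open import Data.Empty using (⊥-elim)
open import Function using (_∘_)
open import Relation.Nullary using (Dec; yes; no; does)
open import Relation.Unary using (Pred; Decidable)
open import Relation.Binary.PropositionalEquality using (_≡_; refl; sym; trans; cong)

filter-does-cong : ∀ {a p q} {A : Set a} {P : Pred A p} {Q : Pred A q} (P? : Decidable P) (Q? : Decidable Q)
                   {xs : List A} → All (λ x → does (P? x) ≡ does (Q? x)) xs → filter P? xs ≡ filter Q? xs
filter-does-cong P? Q? All.[] = refl
filter-does-cong P? Q? {x ∷ _} (same All.∷ rest) with does (P? x) | does (Q? x) | same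
... | true  | true  | refl = cong (x ∷_) (filter-does-cong P? Q? rest)
... | false | false | refl = filter-does-cong P? Q? rest
... | true  | false | ()
... | false | true  | ()

lookup-injective : ∀ {a} {A : Set a} {xs : List A} → Unique xs → ∀ i j → lookup xs i ≡ lookup xs j → i ≡ j
lookup-injective (_ ∷ _)  Fin.zero    Fin.zero    _  = refl
lookup-injective (x∉ ∷ _) Fin.zero    (Fin.suc j) eq = ⊥-elim (All.lookup x∉ (∈-lookup j) eq)
lookup-injective (x∉ ∷ _) (Fin.suc i) Fin.zero    eq = ⊥-elim (All.lookup x∉ (∈-lookup i) (sym eq))
lookup-injective (_ ∷ u)  (Fin.suc i) (Fin.suc j) eq = cong Fin.suc (lookup-injective u i j eq)

Unique∧⊆⇒length≤ : ∀ {a} {A : Set a} {xs ys : List A} → Unique xs → xs ⊆ ys → length xs ℕ.≤ length ys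
Unique∧⊆⇒length≤ {xs = xs} {ys} unique xs⊆ys = ℕ.≮⇒≥ ¬ys<xs
  where
    position : Fin (length xs) → Fin (length ys)
    position = index ∘ xs⊆ys ∘ ∈-lookup
    ¬ys<xs : ¬ length ys ℕ.< length xs
    ¬ys<xs ys<xs with i , j , i<j , same-position ← Fin.pigeonhole ys<xs position =
      Fin.<⇒≢ i<j (lookup-injective unique i j
        (trans (lookup-index (xs⊆ys (∈-lookup i)))
               (trans (cong (lookup ys) same-position) (sym (lookup-index (xs⊆ys (∈-lookup j)))))))

module Hexagon where
  open import Data.Integer
    using (ℤ; +_; 0ℤ; 1ℤ; -1ℤ; _+_; _-_; -_; _≤_; _<_; _⊔_; _⊓_; suc; pred)
  open import Data.Integer.Properties
    using ( _≟_; _≤?_; ≤-trans; ≤-antisym; <⇒≤; ≤∧≢⇒<; <-irrefl; ≰⇒>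
          ; +-comm; +-identityʳ; +-mono-≤; +-monoˡ-≤; +-monoʳ-≤; i≤i+j; i-j≤i
          ; neg-involutive; neg-distrib-+; neg-mono-≤; neg-mono-<
          ; i<j⇒suc[i]≤j; suc[i]≤j⇒i<j; i<j⇒i≤pred[j]; i≤pred[j]⇒i<j
          ; i≤i⊔j; i≤j⊔i; ⊔-lub; i≥j⇒i⊔j≡i; i≤j⇒i⊔j≡j; i≤j⇒i⊓j≡i; i≥j⇒i⊓j≡j
          ; module ≤-Reasoning )
  open import Data.Integer.Tactic.RingSolver using (solve)
  open import Data.List using (_++_; map)
  open import Data.List.Properties using (length-map)
  open import Data.List.Membership.Propositional.Properties using (∈-++⁺ˡ; ∈-++⁺ʳ; ∈-map⁺)
  open import Data.List.Relation.Unary.Any using (here; there)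
  open import Data.Product using (_×_; ∃₂; proj₁; proj₂; swap)
  open import Data.Sum using (_⊎_; inj₁; inj₂)
  import Data.Sum as Sum
  import Data.Product as Product
  open import Function using (id; _⇔_; mk⇔; Equivalence)
  open import Relation.Nullary.Decidable using (_×-dec_; dec-true; dec-false)
  open import Relation.Binary.PropositionalEquality using (subst; subst₂; cong₂)

  variable
    l u x y z a b c d s δ : ℤ

  [i+j]-j≡i : ∀ i j → (i + j) - j ≡ i
  [i+j]-j≡i i j = solve (i ∷ j ∷ [])

  [i-j]+j≡i : ∀ i j → (i - j) + j ≡ i
  [i-j]+j≡i i j = solve (i ∷ j ∷ [])

  i+[j-i]≡j : ∀ i j → i + (j - i) ≡ j
  i+[j-i]≡j i j = solve (i ∷ j ∷ [])

  i+j≤k⇒i≤k-j : x + y ≤ z → x ≤ z - y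
  i+j≤k⇒i≤k-j {x} {y} {z} h = subst (_≤ z - y) ([i+j]-j≡i x y) (+-monoˡ-≤ (- y) h)

  i≤k-j⇒i+j≤k : x ≤ z - y → x + y ≤ z
  i≤k-j⇒i+j≤k {x} {z} {y} h = subst (x + y ≤_) ([i-j]+j≡i z y) (+-monoˡ-≤ y h)

  k≤i+j⇒k-j≤i : z ≤ x + y → z - y ≤ x
  k≤i+j⇒k-j≤i {z} {x} {y} h = subst (z - y ≤_) ([i+j]-j≡i x y) (+-monoˡ-≤ (- y) h)

  k-j≤i⇒k≤i+j : z - y ≤ x → z ≤ x + y
  k-j≤i⇒k≤i+j {z} {y} {x} h = subst (_≤ x + y) ([i-j]+j≡i z y) (+-monoˡ-≤ y h)

  i+j≡k⇒i≡k-j : x + y ≡ z → x ≡ z - y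
  i+j≡k⇒i≡k-j {x} {y} refl = sym ([i+j]-j≡i x y)

  +-cancelˡ-≤ : ∀ x → x + y ≤ x + z → y ≤ z
  +-cancelˡ-≤ {y} {z} x h = subst₂ _≤_ (cancel y) (cancel z) (+-monoʳ-≤ (- x) h)
    where
      cancel : ∀ w → - x + (x + w) ≡ w
      cancel w = solve (x ∷ w ∷ [])

  i<j⇒i+1≤j : x < y → x + 1ℤ ≤ y
  i<j⇒i+1≤j {x} x<y = subst (_≤ _) (+-comm 1ℤ x) (i<j⇒suc[i]≤j x<y)

  i+1≤j⇒i<j : x + 1ℤ ≤ y → x < y
  i+1≤j⇒i<j {x} h = suc[i]≤j⇒i<j (subst (_≤ _) (+-comm x 1ℤ) h)

  i<j⇒i≤j-1 : x < y → x ≤ y - 1ℤ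
  i<j⇒i≤j-1 {y = y} x<y = subst (_ ≤_) (+-comm -1ℤ y) (i<j⇒i≤pred[j] x<y)

  i≤j-1⇒i<j : x ≤ y - 1ℤ → x < y
  i≤j-1⇒i<j {y = y} h = i≤pred[j]⇒i<j (subst (_ ≤_) (+-comm y -1ℤ) h)

  Within : ℤ → ℤ → ℤ → Set
  Within l u x = l ≤ x × x ≤ u

  Tight : ℤ → ℤ → ℤ → Set
  Tight l u x = x ≡ l ⊎ x ≡ u

  Strict : ℤ → ℤ → ℤ → Set
  Strict l u x = l < x × x < u

  -- A record rather than a product, so that its indices can be recovered by unification.
  record Movable (l u x δ : ℤ) : Set where
    constructor movable
    field
      up   : Within l u (x + δ)
      down : Within l u (x - δ)

  tight⊎strict : Within l u x → Tight l u x ⊎ Strict l u x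
  tight⊎strict {l} {u} {x} (l≤x , x≤u) with x ≟ l | x ≟ u
  ... | yes x≡l | _       = inj₁ (inj₁ x≡l)
  ... | no _    | yes x≡u = inj₁ (inj₂ x≡u)
  ... | no x≢l  | no x≢u  = inj₂ (≤∧≢⇒< l≤x (x≢l ∘ sym) , ≤∧≢⇒< x≤u x≢u)

  strict⇒within : Strict l u x → Within l u x
  strict⇒within (l<x , x<u) = <⇒≤ l<x , <⇒≤ x<u

  within-neg : Within l u x → Within (- u) (- l) (- x)
  within-neg (l≤x , x≤u) = neg-mono-≤ x≤u , neg-mono-≤ l≤x

  tight-neg : Tight l u x → Tight (- u) (- l) (- x)
  tight-neg = Sum.swap ∘ Sum.map (cong (-_)) (cong (-_))

  movable-neg : Movable l u x δ → Movable l u x (- δ)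
  movable-neg {l} {u} {x} {δ} (movable up down) =
    movable down (subst (λ e → Within l u (x + e)) (sym (neg-involutive δ)) up)

  movable-0 : Within l u x → Movable l u x 0ℤ
  movable-0 {l} {u} {x} w = movable w+0 w+0
    where
      w+0 : Within l u (x + 0ℤ)
      w+0 = subst (Within l u) (sym (+-identityʳ x)) w

  movable-1 : Strict l u x → Movable l u x 1ℤ
  movable-1 {x = x} (l<x , x<u) =
    movable (≤-trans (<⇒≤ l<x) (i≤i+j x 1ℤ) , i<j⇒i+1≤j x<u) (i<j⇒i≤j-1 l<x , ≤-trans (i-j≤i x 1ℤ) (<⇒≤ x<u))

  movable-−1 : Strict l u x → Movable l u x (- 1ℤ)
  movable-−1 = movable-neg ∘ movable-1

  ¬movable-1 : Tight l u x → ¬ Movable l u x 1ℤ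
  ¬movable-1 (inj₁ refl) (movable _ (x≤x-1 , _)) = <-irrefl refl (i≤j-1⇒i<j x≤x-1)
  ¬movable-1 (inj₂ refl) (movable (_ , x+1≤x) _) = <-irrefl refl (i+1≤j⇒i<j x+1≤x)

  ¬movable-−1 : Tight l u x → ¬ Movable l u x (- 1ℤ)
  ¬movable-−1 tight = ¬movable-1 tight ∘ movable-neg

  ⊔-attained : a ≤ x → b ≤ x → x ≡ a ⊎ x ≡ b → x ≡ a ⊔ b
  ⊔-attained a≤x b≤x (inj₁ refl) = sym (i≥j⇒i⊔j≡i b≤x)
  ⊔-attained a≤x b≤x (inj₂ refl) = sym (i≤j⇒i⊔j≡j a≤x)

  ⊓-attained : x ≤ a → x ≤ b → x ≡ a ⊎ x ≡ b → x ≡ a ⊓ b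
  ⊓-attained x≤a x≤b (inj₁ refl) = sym (i≤j⇒i⊓j≡i x≤b)
  ⊓-attained x≤a x≤b (inj₂ refl) = sym (i≥j⇒i⊓j≡j x≤a)

  thin-values : l ≤ x → x ≤ u → u ≤ suc l → x ≡ l ⊎ x ≡ suc l
  thin-values {l} {x} l≤x x≤u u≤1+l with x ≟ l
  ... | yes x≡l = inj₁ x≡l
  ... | no x≢l  = inj₂ (≤-antisym (≤-trans x≤u u≤1+l) (i<j⇒suc[i]≤j (≤∧≢⇒< l≤x (x≢l ∘ sym))))

  far-end-forces : suc a < x → b ≤ y → x + y ≤ s → s ≤ suc a + suc b → y ≡ b × x + y ≡ s
  far-end-forces {a} {x} {b} {y} {s} a+1<x b≤y x+y≤s s≤ =
    ≤-antisym (+-cancelˡ-≤ x (≤-trans x+y≤s s≤x+b)) b≤y , ≤-antisym x+y≤s (≤-trans s≤x+b (+-monoʳ-≤ x b≤y))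
    where
      open ≤-Reasoning
      s≤x+b : s ≤ x + b
      s≤x+b = begin
        s                   ≤⟨ s≤ ⟩
        1ℤ + a + (1ℤ + b)   ≡⟨ solve (a ∷ b ∷ []) ⟩
        1ℤ + (1ℤ + a) + b   ≤⟨ +-monoˡ-≤ b (i<j⇒suc[i]≤j a+1<x) ⟩
        x + b               ∎

  near-end-forces : suc s < u → a ≤ x → b ≤ y → u ≤ suc a + suc b → x + y ≡ s → x ≡ a × y ≡ b
  near-end-forces {s} {u} {a} {x} {b} {y} s+1<u a≤x b≤y u≤ refl =
    ≤-antisym (+-cancelˡ-≤ b b+x≤b+a) a≤x , ≤-antisym (+-cancelˡ-≤ a a+y≤a+b) b≤y
    where
      open ≤-Reasoning
      x+y≤a+b : x + y ≤ a + b
      x+y≤a+b = +-cancelˡ-≤ (+ 2) (begin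
        + 2 + (x + y)          ≡⟨ solve (x ∷ y ∷ []) ⟩
        1ℤ + (1ℤ + (x + y))    ≤⟨ i<j⇒suc[i]≤j s+1<u ⟩
        u                      ≤⟨ u≤ ⟩
        1ℤ + a + (1ℤ + b)      ≡⟨ solve (a ∷ b ∷ []) ⟩
        + 2 + (a + b)          ∎)
      b+x≤b+a : b + x ≤ b + a
      b+x≤b+a = begin
        b + x  ≡⟨ +-comm b x ⟩
        x + b  ≤⟨ +-monoʳ-≤ x b≤y ⟩
        x + y  ≤⟨ x+y≤a+b ⟩
        a + b  ≡⟨ +-comm a b ⟩
        b + a  ∎
      a+y≤a+b : a + y ≤ a + b
      a+y≤a+b = ≤-trans (+-monoˡ-≤ y a≤x) x+y≤a+b

  split-sum : ∀ {a a′ b b′ s} → a ≤ a′ → b ≤ b′ → a + b ≤ s → s ≤ a′ + b′ →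
              ∃₂ λ x y → Within a a′ x × Within b b′ y × x + y ≡ s
  split-sum {a} {a′} {b} {b′} {s} a≤a′ b≤b′ a+b≤s s≤a′+b′ =
    t , s - t , (i≤i⊔j a (s - b′) , t≤a′) , (b≤s-t , s-t≤b′) , i+[j-i]≡j t s
    where
      t : ℤ
      t = a ⊔ (s - b′)
      t≤a′ : t ≤ a′
      t≤a′ = ⊔-lub a≤a′ (k≤i+j⇒k-j≤i s≤a′+b′)
      t≤s-b : t ≤ s - b
      t≤s-b = ⊔-lub (i+j≤k⇒i≤k-j a+b≤s) (+-monoʳ-≤ s (neg-mono-≤ b≤b′))
      b≤s-t : b ≤ s - t
      b≤s-t = i+j≤k⇒i≤k-j (subst (_≤ s) (+-comm t b) (i≤k-j⇒i+j≤k t≤s-b))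
      s-t≤b′ : s - t ≤ b′
      s-t≤b′ = k≤i+j⇒k-j≤i (subst (s ≤_) (+-comm t b′) (k-j≤i⇒k≤i+j (i≤j⊔i a (s - b′))))

  suc-pred-within⇒strict : Within (suc l) (pred u) x → Strict l u x
  suc-pred-within⇒strict (1+l≤x , x≤u-1) = suc[i]≤j⇒i<j 1+l≤x , i≤pred[j]⇒i<j x≤u-1

  suc[i]<j⇒suc[-j]<-i : suc x < y → suc (- y) < - x
  suc[i]<j⇒suc[-j]<-i {x} {y} x+1<y =
    i≤pred[j]⇒i<j (i<j⇒suc[i]≤j (subst (- y <_) (neg-distrib-+ 1ℤ x) (neg-mono-< x+1<y)))

  pred[i]+pred[j]≤k⇒-k≤suc[-i]+suc[-j] : pred x + pred y ≤ z → - z ≤ suc (- x) + suc (- y)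
  pred[i]+pred[j]≤k⇒-k≤suc[-i]+suc[-j] {x} {y} {z} h = subst (- z ≤_) negate-preds (neg-mono-≤ h)
    where
      negate-preds : - (-1ℤ + x + (-1ℤ + y)) ≡ 1ℤ + - x + (1ℤ + - y)
      negate-preds = solve (x ∷ y ∷ [])

  TwoOf : Set → Set → Set → Set
  TwoOf P Q R = (P × Q) ⊎ (P × R) ⊎ (Q × R)

  TwoOf-map : ∀ {P Q R P′ Q′ R′ : Set} → (P → P′) → (Q → Q′) → (R → R′) → TwoOf P Q R → TwoOf P′ Q′ R′
  TwoOf-map f g h = Sum.map (Product.map f g) (Sum.map (Product.map f h) (Product.map g h))

  TwoOf-swap₁₂ : ∀ {P Q R : Set} → TwoOf P Q R → TwoOf Q P R
  TwoOf-swap₁₂ (inj₁ (p , q))         = inj₁ (q , p)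
  TwoOf-swap₁₂ (inj₂ (inj₁ (p , r)))  = inj₂ (inj₂ (p , r))
  TwoOf-swap₁₂ (inj₂ (inj₂ (q , r)))  = inj₂ (inj₁ (q , r))

  TwoOf-swap₂₃ : ∀ {P Q R : Set} → TwoOf P Q R → TwoOf P R Q
  TwoOf-swap₂₃ (inj₁ (p , q))         = inj₂ (inj₁ (p , q))
  TwoOf-swap₂₃ (inj₂ (inj₁ (p , r)))  = inj₁ (p , r)
  TwoOf-swap₂₃ (inj₂ (inj₂ (q , r)))  = inj₂ (inj₂ (r , q))

  TwoOf⇒first⊎third : ∀ {P Q R : Set} → TwoOf P Q R → P ⊎ R
  TwoOf⇒first⊎third (inj₁ (p , _))         = inj₁ p
  TwoOf⇒first⊎third (inj₂ (inj₁ (p , _)))  = inj₁ p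
  TwoOf⇒first⊎third (inj₂ (inj₂ (_ , r)))  = inj₂ r

  TwoOf-collapse : ∀ {P Q R : Set} → TwoOf (P ⊎ (Q × R)) (Q ⊎ (P × R)) (R ⊎ (P × Q)) → TwoOf P Q R
  TwoOf-collapse (inj₁ (inj₁ p , inj₁ q))                = inj₁ (p , q)
  TwoOf-collapse (inj₁ (inj₂ (q , r) , _))               = inj₂ (inj₂ (q , r))
  TwoOf-collapse (inj₁ (_ , inj₂ (p , r)))               = inj₂ (inj₁ (p , r))
  TwoOf-collapse (inj₂ (inj₁ (inj₁ p , inj₁ r)))         = inj₂ (inj₁ (p , r))
  TwoOf-collapse (inj₂ (inj₁ (inj₂ (q , r) , _)))        = inj₂ (inj₂ (q , r))
  TwoOf-collapse (inj₂ (inj₁ (_ , inj₂ (p , q))))        = inj₁ (p , q)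
  TwoOf-collapse (inj₂ (inj₂ (inj₁ q , inj₁ r)))         = inj₂ (inj₂ (q , r))
  TwoOf-collapse (inj₂ (inj₂ (inj₂ (p , r) , _)))        = inj₂ (inj₁ (p , r))
  TwoOf-collapse (inj₂ (inj₂ (_ , inj₂ (p , q))))        = inj₁ (p , q)

  determined-by-two : ∀ {α β} → TwoOf (α + β ≡ s) (α ≡ a) (β ≡ b) → (α , β) ∈ (a , s - a) ∷ (s - b , b) ∷ (a , b) ∷ []
  determined-by-two {a = a} {β = β} (inj₁ (σ≡s , refl)) = here (cong (a ,_) (i+j≡k⇒i≡k-j (trans (+-comm β a) σ≡s)))
  determined-by-two {b = b} (inj₂ (inj₁ (σ≡s , refl)))  = there (here (cong (_, b) (i+j≡k⇒i≡k-j σ≡s)))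
  determined-by-two (inj₂ (inj₂ (refl , refl)))         = there (there (here refl))

  Corner : Bounds → Pair → Set
  Corner B (α , β) = InΠ B (α , β) × TwoOf (Tight ℓ₀ u₀ (α + β)) (Tight ℓ₁ u₁ α) (Tight ℓ₂ u₂ β)
    where open Bounds B

  module _ {B : Bounds} where
    open Bounds B

    ±-in-Π⇔ : ∀ {α β c d} →
              (InΠ B ((α , β) ⊕ (c , d)) × InΠ B ((α , β) ⊖ (c , d)))
              ⇔ (Movable ℓ₀ u₀ (α + β) (c + d) × Movable ℓ₁ u₁ α c × Movable ℓ₂ u₂ β d)
    ±-in-Π⇔ {α} {β} {c} {d} = mk⇔
      (λ ((σ₊ , α₊ , β₊) , (σ₋ , α₋ , β₋)) →
         movable (subst (Within ℓ₀ u₀) shift₊ σ₊) (subst (Within ℓ₀ u₀) shift₋ σ₋) , movable α₊ α₋ , movable β₊ β₋)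
      (λ (movable σ₊ σ₋ , movable α₊ α₋ , movable β₊ β₋) →
         (subst (Within ℓ₀ u₀) (sym shift₊) σ₊ , α₊ , β₊) , (subst (Within ℓ₀ u₀) (sym shift₋) σ₋ , α₋ , β₋))
      where
        shift₊ : (α + c) + (β + d) ≡ (α + β) + (c + d)
        shift₊ = solve (α ∷ β ∷ c ∷ d ∷ [])
        shift₋ : (α - c) + (β - d) ≡ (α + β) - (c + d)
        shift₋ = solve (α ∷ β ∷ c ∷ d ∷ [])

    strict⇒interior : ∀ {α β} → Strict ℓ₀ u₀ (α + β) → Strict ℓ₁ u₁ α → Strict ℓ₂ u₂ β → Interior B (α , β)
    strict⇒interior {α} {β} sσ sα sβ =
        (strict⇒within sσ , strict⇒within sα , strict⇒within sβ)
      , step (movable-1 sσ)  (movable-1 sα)  (stay sβ)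
      All.∷ step (movable-−1 sσ) (movable-−1 sα) (stay sβ)
      All.∷ step (movable-1 sσ)  (stay sα)       (movable-1 sβ)
      All.∷ step (movable-−1 sσ) (stay sα)       (movable-−1 sβ)
      All.∷ step (stay sσ)       (movable-1 sα)  (movable-−1 sβ)
      All.∷ step (stay sσ)       (movable-−1 sα) (movable-1 sβ)
      All.∷ All.[]
      where
        stay : Strict l u x → Movable l u x 0ℤ
        stay = movable-0 ∘ strict⇒within
        step : Movable ℓ₀ u₀ (α + β) (c + d) → Movable ℓ₁ u₁ α c → Movable ℓ₂ u₂ β d → InΠ B ((α , β) ⊕ (c , d))
        step mσ mα mβ = proj₁ (Equivalence.from ±-in-Π⇔ (mσ , mα , mβ))

    both? : (p v : Pair) → Dec (InΠ B (p ⊕ v) × InΠ B (p ⊖ v))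
    both? p v = inΠ? B (p ⊕ v) ×-dec inΠ? B (p ⊖ v)

    module _ {α β : ℤ} where

      accept : ∀ c d → Movable ℓ₀ u₀ (α + β) (c + d) → Movable ℓ₁ u₁ α c → Movable ℓ₂ u₂ β d →
               does (both? (α , β) (c , d)) ≡ true
      accept c d mσ mα mβ = dec-true (both? (α , β) (c , d)) (Equivalence.from ±-in-Π⇔ (mσ , mα , mβ))

      reject-σ : ∀ c d → ¬ Movable ℓ₀ u₀ (α + β) (c + d) → does (both? (α , β) (c , d)) ≡ false
      reject-σ c d ¬m = dec-false (both? (α , β) (c , d)) (¬m ∘ proj₁ ∘ Equivalence.to (±-in-Π⇔ {α} {β} {c} {d}))

      reject-α : ∀ c d → ¬ Movable ℓ₁ u₁ α c → does (both? (α , β) (c , d)) ≡ false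
      reject-α c d ¬m = dec-false (both? (α , β) (c , d)) (¬m ∘ proj₁ ∘ proj₂ ∘ Equivalence.to (±-in-Π⇔ {α} {β} {c} {d}))

      reject-β : ∀ c d → ¬ Movable ℓ₂ u₂ β d → does (both? (α , β) (c , d)) ≡ false
      reject-β c d ¬m = dec-false (both? (α , β) (c , d)) (¬m ∘ proj₂ ∘ proj₂ ∘ Equivalence.to (±-in-Π⇔ {α} {β} {c} {d}))

      tight-σ⇒border : InΠ B (α , β) → Tight ℓ₀ u₀ (α + β) → Strict ℓ₁ u₁ α → Strict ℓ₂ u₂ β → Border B (α , β)
      tight-σ⇒border X@(Xσ , _) t sα sβ =
        X , cong length (filter-does-cong (both? (α , β)) (λ (c , d) → c + d ≟ 0ℤ)
          (     reject-σ 1ℤ 0ℤ (¬movable-1 t)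
          All.∷ reject-σ (- 1ℤ) 0ℤ (¬movable-−1 t)
          All.∷ reject-σ 0ℤ 1ℤ (¬movable-1 t)
          All.∷ reject-σ 0ℤ (- 1ℤ) (¬movable-−1 t)
          All.∷ accept 1ℤ (- 1ℤ) (movable-0 Xσ) (movable-1 sα) (movable-−1 sβ)
          All.∷ accept (- 1ℤ) 1ℤ (movable-0 Xσ) (movable-−1 sα) (movable-1 sβ)
          All.∷ All.[]))

      tight-α⇒border : InΠ B (α , β) → Tight ℓ₁ u₁ α → Strict ℓ₀ u₀ (α + β) → Strict ℓ₂ u₂ β → Border B (α , β)
      tight-α⇒border X@(_ , Xα , _) t sσ sβ =
        X , cong length (filter-does-cong (both? (α , β)) (λ (c , _) → c ≟ 0ℤ)
          (     reject-α 1ℤ 0ℤ (¬movable-1 t)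
          All.∷ reject-α (- 1ℤ) 0ℤ (¬movable-−1 t)
          All.∷ accept 0ℤ 1ℤ (movable-1 sσ) (movable-0 Xα) (movable-1 sβ)
          All.∷ accept 0ℤ (- 1ℤ) (movable-−1 sσ) (movable-0 Xα) (movable-−1 sβ)
          All.∷ reject-α 1ℤ (- 1ℤ) (¬movable-1 t)
          All.∷ reject-α (- 1ℤ) 1ℤ (¬movable-−1 t)
          All.∷ All.[]))

      tight-β⇒border : InΠ B (α , β) → Tight ℓ₂ u₂ β → Strict ℓ₀ u₀ (α + β) → Strict ℓ₁ u₁ α → Border B (α , β)
      tight-β⇒border X@(_ , _ , Xβ) t sσ sα =
        X , cong length (filter-does-cong (both? (α , β)) (λ (_ , d) → d ≟ 0ℤ)
          (     accept 1ℤ 0ℤ (movable-1 sσ) (movable-1 sα) (movable-0 Xβ)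
          All.∷ accept (- 1ℤ) 0ℤ (movable-−1 sσ) (movable-−1 sα) (movable-0 Xβ)
          All.∷ reject-β 0ℤ 1ℤ (¬movable-1 t)
          All.∷ reject-β 0ℤ (- 1ℤ) (¬movable-−1 t)
          All.∷ reject-β 1ℤ (- 1ℤ) (¬movable-−1 t)
          All.∷ reject-β (- 1ℤ) 1ℤ (¬movable-1 t)
          All.∷ All.[]))

    vertex⇒corner : ∀ {p} → Vertex B p → Corner B p
    vertex⇒corner {α , β} (X@(Xσ , Xα , Xβ) , not-interior , not-border)
      with tight⊎strict Xσ | tight⊎strict Xα | tight⊎strict Xβ
    ... | inj₁ tσ | inj₁ tα | _       = X , inj₁ (tσ , tα)
    ... | inj₁ tσ | inj₂ _  | inj₁ tβ = X , inj₂ (inj₁ (tσ , tβ))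
    ... | inj₂ _  | inj₁ tα | inj₁ tβ = X , inj₂ (inj₂ (tα , tβ))
    ... | inj₁ tσ | inj₂ sα | inj₂ sβ = ⊥-elim (not-border (tight-σ⇒border X tσ sα sβ))
    ... | inj₂ sσ | inj₁ tα | inj₂ sβ = ⊥-elim (not-border (tight-α⇒border X tα sσ sβ))
    ... | inj₂ sσ | inj₂ sα | inj₁ tβ = ⊥-elim (not-border (tight-β⇒border X tβ sσ sα))
    ... | inj₂ sσ | inj₂ sα | inj₂ sβ = ⊥-elim (not-interior (strict⇒interior sσ sα sβ))

  CornersAmong : Bounds → List Pair → Set
  CornersAmong B cs = ∀ {p} → Corner B p → p ∈ cs

  record FewCorners (B : Bounds) : Set where
    constructor few-corners
    field
      candidates   : List Pair
      at-most-four : length candidates ℕ.≤ 4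
      among        : CornersAmong B candidates

  record Symmetry (B B′ : Bounds) : Set where
    field
      act        : Pair → Pair
      involutive : ∀ p → act (act p) ≡ p
      act-corner : ∀ {p} → Corner B p → Corner B′ (act p)

  pull-back : ∀ {B B′} → Symmetry B B′ → FewCorners B′ → FewCorners B
  pull-back g (few-corners cs few among) =
    few-corners
      (map act cs)
      (subst (ℕ._≤ 4) (sym (length-map act cs)) few)
      λ {p} corner → subst (_∈ map act cs) (involutive p) (∈-map⁺ act (among (act-corner corner)))
    where open Symmetry g

  shear : Pair → Pair
  shear (α , β) = (α + β , - β)

  negate : Pair → Pair
  negate (α , β) = (- α , - β)

  module _ {B : Bounds} where
    open Bounds B

    lowest highest : ℤ → ℤ
    lowest α = ℓ₂ ⊔ (ℓ₀ - α)
    highest α = u₂ ⊓ (u₀ - α)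

    fibreEnds : ℤ → List Pair
    fibreEnds α = (α , lowest α) ∷ (α , highest α) ∷ []

    ∈-fibreEnds : ∀ {α β a} → α ≡ a → β ≡ lowest α ⊎ β ≡ highest α → (α , β) ∈ fibreEnds a
    ∈-fibreEnds refl (inj₁ refl) = here refl
    ∈-fibreEnds refl (inj₂ refl) = there (here refl)

    fibre-end : ∀ {α β} → InΠ B (α , β) → Tight ℓ₀ u₀ (α + β) ⊎ Tight ℓ₂ u₂ β → β ≡ lowest α ⊎ β ≡ highest α
    fibre-end {α} {β} ((ℓ₀≤σ , σ≤u₀) , _ , (ℓ₂≤β , β≤u₂)) =
      Sum.map (⊔-attained ℓ₂≤β (k≤i+j⇒k-j≤i (subst (ℓ₀ ≤_) (+-comm α β) ℓ₀≤σ)))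
              (⊓-attained β≤u₂ (i+j≤k⇒i≤k-j (subst (_≤ u₀) (+-comm α β) σ≤u₀)))
      ∘ ends
      where
        ends : Tight ℓ₀ u₀ (α + β) ⊎ Tight ℓ₂ u₂ β → (β ≡ ℓ₂ ⊎ β ≡ ℓ₀ - α) ⊎ (β ≡ u₂ ⊎ β ≡ u₀ - α)
        ends (inj₁ (inj₁ σ≡ℓ₀)) = inj₁ (inj₂ (i+j≡k⇒i≡k-j (trans (+-comm β α) σ≡ℓ₀)))
        ends (inj₁ (inj₂ σ≡u₀)) = inj₂ (inj₂ (i+j≡k⇒i≡k-j (trans (+-comm β α) σ≡u₀)))
        ends (inj₂ (inj₁ β≡ℓ₂)) = inj₁ (inj₁ β≡ℓ₂)
        ends (inj₂ (inj₂ β≡u₂)) = inj₂ (inj₁ β≡u₂)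

    thin⇒few-corners : u₁ ≤ suc ℓ₁ → FewCorners B
    thin⇒few-corners thin = few-corners (fibreEnds ℓ₁ ++ fibreEnds (suc ℓ₁)) ℕ.≤-refl among
      where
        among : CornersAmong B (fibreEnds ℓ₁ ++ fibreEnds (suc ℓ₁))
        among {α , β} (X@(_ , (ℓ₁≤α , α≤u₁) , _) , two)
          with thin-values ℓ₁≤α α≤u₁ thin | fibre-end X (TwoOf⇒first⊎third two)
        ... | inj₁ α≡ℓ₁   | end = ∈-++⁺ˡ (∈-fibreEnds α≡ℓ₁ end)
        ... | inj₂ α≡1+ℓ₁ | end = ∈-++⁺ʳ (fibreEnds ℓ₁) (∈-fibreEnds α≡1+ℓ₁ end)

    small-triangle⇒few-corners : suc ℓ₀ < u₀ → suc ℓ₁ < u₁ → suc ℓ₂ < u₂ → u₀ ≤ suc ℓ₁ + suc ℓ₂ → FewCorners B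
    small-triangle⇒few-corners wide₀ wide₁ wide₂ small =
      few-corners ((ℓ₁ , u₀ - ℓ₁) ∷ (u₀ - ℓ₂ , ℓ₂) ∷ (ℓ₁ , ℓ₂) ∷ []) (ℕ.n≤1+n 3) (determined-by-two ∘ inner)
      where
        inner : ∀ {α β} → Corner B (α , β) → TwoOf (α + β ≡ u₀) (α ≡ ℓ₁) (β ≡ ℓ₂)
        inner {α} {β} (((_ , σ≤u₀) , (ℓ₁≤α , _) , (ℓ₂≤β , _)) , two) = TwoOf-collapse (TwoOf-map tσ tα tβ two)
          where
            tσ : Tight ℓ₀ u₀ (α + β) → α + β ≡ u₀ ⊎ (α ≡ ℓ₁ × β ≡ ℓ₂)
            tσ (inj₁ σ≡ℓ₀) = inj₂ (near-end-forces wide₀ ℓ₁≤α ℓ₂≤β small σ≡ℓ₀)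
            tσ (inj₂ σ≡u₀) = inj₁ σ≡u₀
            tα : Tight ℓ₁ u₁ α → α ≡ ℓ₁ ⊎ (α + β ≡ u₀ × β ≡ ℓ₂)
            tα (inj₁ α≡ℓ₁) = inj₁ α≡ℓ₁
            tα (inj₂ α≡u₁) = inj₂ (swap (far-end-forces {a = ℓ₁} (subst (suc ℓ₁ <_) (sym α≡u₁) wide₁) ℓ₂≤β σ≤u₀ small))
            tβ : Tight ℓ₂ u₂ β → β ≡ ℓ₂ ⊎ (α + β ≡ u₀ × α ≡ ℓ₁)
            tβ (inj₁ β≡ℓ₂) = inj₁ β≡ℓ₂
            tβ (inj₂ β≡u₂) =
              let α≡ℓ₁ , β+α≡u₀ = far-end-forces {a = ℓ₂} (subst (suc ℓ₂ <_) (sym β≡u₂) wide₂) ℓ₁≤α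
                                    (subst (_≤ u₀) (+-comm α β) σ≤u₀) (subst (u₀ ≤_) (+-comm (suc ℓ₁) (suc ℓ₂)) small)
              in inj₂ (trans (+-comm α β) β+α≡u₀ , α≡ℓ₁)

    wide⇒interior : suc ℓ₀ < u₀ → suc ℓ₁ < u₁ → suc ℓ₂ < u₂ → suc ℓ₁ + suc ℓ₂ < u₀ → ℓ₀ < pred u₁ + pred u₂ →
                    Σ Pair (Interior B)
    wide⇒interior wide₀ wide₁ wide₂ lower upper =
      let α , β , α-inside , β-inside , α+β≡target =
            split-sum (i<j⇒i≤pred[j] wide₁) (i<j⇒i≤pred[j] wide₂) (i≤i⊔j _ _) target≤pred₁+pred₂
      in  (α , β)
        , strict⇒interior (suc-pred-within⇒strict (subst (Within (suc ℓ₀) (pred u₀)) (sym α+β≡target) target-inside))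
                          (suc-pred-within⇒strict α-inside) (suc-pred-within⇒strict β-inside)
      where
        target : ℤ
        target = (suc ℓ₁ + suc ℓ₂) ⊔ suc ℓ₀
        target-inside : Within (suc ℓ₀) (pred u₀) target
        target-inside = i≤j⊔i _ _ , ⊔-lub (i<j⇒i≤pred[j] lower) (i<j⇒i≤pred[j] wide₀)
        target≤pred₁+pred₂ : target ≤ pred u₁ + pred u₂
        target≤pred₁+pred₂ = ⊔-lub (+-mono-≤ (i<j⇒i≤pred[j] wide₁) (i<j⇒i≤pred[j] wide₂)) (i<j⇒suc[i]≤j upper)

  module _ {B : Bounds} where
    open Bounds B

    swap-symmetry : Symmetry B (bounds ℓ₀ u₀ ℓ₂ u₂ ℓ₁ u₁)
    swap-symmetry = record { act = swap ; involutive = λ _ → refl ; act-corner = swap-corner }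
      where
        swap-corner : ∀ {p} → Corner B p → Corner (bounds ℓ₀ u₀ ℓ₂ u₂ ℓ₁ u₁) (swap p)
        swap-corner {α , β} ((Xσ , Xα , Xβ) , two) =
            (subst (Within ℓ₀ u₀) (+-comm α β) Xσ , Xβ , Xα)
          , TwoOf-map (subst (Tight ℓ₀ u₀) (+-comm α β)) id id (TwoOf-swap₂₃ two)

    shear-symmetry : Symmetry B (bounds ℓ₁ u₁ ℓ₀ u₀ (- u₂) (- ℓ₂))
    shear-symmetry = record { act = shear ; involutive = shear-involutive ; act-corner = shear-corner }
      where
        shear-involutive : ∀ p → shear (shear p) ≡ p
        shear-involutive (α , β) = cong₂ _,_ ([i+j]-j≡i α β) (neg-involutive β)
        shear-corner : ∀ {p} → Corner B p → Corner (bounds ℓ₁ u₁ ℓ₀ u₀ (- u₂) (- ℓ₂)) (shear p)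
        shear-corner {α , β} ((Xσ , Xα , Xβ) , two) =
            (subst (Within ℓ₁ u₁) α≡α+β-β Xα , Xσ , within-neg Xβ)
          , TwoOf-map (subst (Tight ℓ₁ u₁) α≡α+β-β) id tight-neg (TwoOf-swap₁₂ two)
          where
            α≡α+β-β : α ≡ (α + β) - β
            α≡α+β-β = sym ([i+j]-j≡i α β)

    negation-symmetry : Symmetry B (bounds (- u₀) (- ℓ₀) (- u₁) (- ℓ₁) (- u₂) (- ℓ₂))
    negation-symmetry = record { act = negate ; involutive = negate-involutive ; act-corner = negate-corner }
      where
        negate-involutive : ∀ p → negate (negate p) ≡ p
        negate-involutive (α , β) = cong₂ _,_ (neg-involutive α) (neg-involutive β)
        negate-corner : ∀ {p} → Corner B p → Corner (bounds (- u₀) (- ℓ₀) (- u₁) (- ℓ₁) (- u₂) (- ℓ₂)) (negate p)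
        negate-corner {α , β} ((Xσ , Xα , Xβ) , two) =
            (subst (Within (- u₀) (- ℓ₀)) (neg-distrib-+ α β) (within-neg Xσ) , within-neg Xα , within-neg Xβ)
          , TwoOf-map (subst (Tight (- u₀) (- ℓ₀)) (neg-distrib-+ α β) ∘ tight-neg) tight-neg tight-neg two

    no-interior⇒few-corners : ¬ Σ Pair (Interior B) → FewCorners B
    no-interior⇒few-corners no-interior with u₁ ≤? suc ℓ₁ | u₂ ≤? suc ℓ₂ | u₀ ≤? suc ℓ₀
    ... | yes thin₁ | _         | _         = thin⇒few-corners thin₁
    ... | no _      | yes thin₂ | _         = pull-back swap-symmetry (thin⇒few-corners thin₂)
    ... | no _      | no _      | yes thin₀ = pull-back shear-symmetry (thin⇒few-corners thin₀)
    ... | no ¬thin₁ | no ¬thin₂ | no ¬thin₀ = all-wide (≰⇒> ¬thin₀) (≰⇒> ¬thin₁) (≰⇒> ¬thin₂)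
      where
        all-wide : suc ℓ₀ < u₀ → suc ℓ₁ < u₁ → suc ℓ₂ < u₂ → FewCorners B
        all-wide wide₀ wide₁ wide₂ with u₀ ≤? suc ℓ₁ + suc ℓ₂ | pred u₁ + pred u₂ ≤? ℓ₀
        ... | yes small-lower | _ = small-triangle⇒few-corners wide₀ wide₁ wide₂ small-lower
        ... | no _ | yes small-upper =
          pull-back negation-symmetry
            (small-triangle⇒few-corners (suc[i]<j⇒suc[-j]<-i wide₀) (suc[i]<j⇒suc[-j]<-i wide₁) (suc[i]<j⇒suc[-j]<-i wide₂)
                                        (pred[i]+pred[j]≤k⇒-k≤suc[-i]+suc[-j] {u₁} {u₂} small-upper))
        ... | no ¬small-lower | no ¬small-upper =
          ⊥-elim (no-interior (wide⇒interior wide₀ wide₁ wide₂ (≰⇒> ¬small-lower) (≰⇒> ¬small-upper)))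

open Hexagon using (vertex⇒corner; no-interior⇒few-corners; module FewCorners)
open import Data.Nat using (_≤_)

lemma4p15 : (B : Bounds) →
    (¬ Σ Pair (λ p → Interior B p)) →
    (vs : List Pair) → Unique vs → All (Vertex B) vs → length vs ≤ 4
lemma4p15 B no-interior vs unique vertices =
  ℕ.≤-trans (Unique∧⊆⇒length≤ unique (among ∘ vertex⇒corner ∘ All.lookup vertices)) at-most-four
  where open FewCorners (no-interior⇒few-corners no-interior)
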